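{- For every $k\in\mathbb{N}$ (with $k\ge1$), $$j_k(0)=-\tfrac12\bigl(1-2^{ -k}\bigr)<0,$$ and $j_k(0)\le j_k(\tau)$ for all $\tau\in\mathbb{G}_k$.
   Context: For $k\in\mathbb{N}$ let $\mathbb{G}_k=(\mathbb{Z}/2\mathbb{Z})^k$ with $\sigma\cdot\tau=\sum_{i=1}^k\sigma_i\tau_i$. Define $\hat h_k,\hat r_k:\{0,\dots,2^k\}\to\mathbb{N}_0$ recursively by $\hat h_0(0)=\hat h_0(1)=1$, $\hat r_0(0)=0$, $\hat r_0(1)=1$, and for $s\in\{0,\dots,2^k\}$: $\hat h_{k+1}(2s)=\hat h_k(s)$, $\hat r_{k+1}(2s)=\hat r_k(s)$; for $s\in\{0,\dots,2^k-1\}$: $\hat h_{k+1}(2s+1)=\hat h_k(s)+\hat h_k(s+1)$, $\hat r_{k+1}(2s+1)=\hat r_k(s)+\hat r_k(s+1)$. The Farey function is $F_k(\sigma)=\hat r_k(s)/\hat h_k(s)$ with $s=\sum_{i=1}^k\sigma_i2^{k-i}$, and the interaction coefficients are $j_k(\tau)=-2^{ -k}\sum_{\sigma\in\mathbb{G}_k}(-1)^{\sigma\cdot\tau}F_k(\sigma)$ for $\tau\in\mathbb{G}_k$. -}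

module Defs where

open import Data.Nat as ℕ using (ℕ; zero; suc; _+_; _*_; _^_)
open import Data.Nat.DivMod using (_/_; _%_)
open import Data.Bool using (Bool; true; false; _xor_; if_then_else_)
open import Data.Vec using (Vec; []; _∷_; allFin)
open import Data.List using (List; []; _∷_; map; _++_; foldr)
open import Data.Rational as ℚ using (ℚ; 0ℚ; 1ℚ; normalize; _-_; -_)
import Data.Rational as Q

-- The group G_k = (Z/2Z)^k, elements as Boolean vectors of length k
-- (true = 1). σ = (σ_1, …, σ_k) is the vector σ_1 ∷ … ∷ σ_k ∷ [].
G : ℕ → Set
G k = Vec Bool k

elems : (k : ℕ) → List (G k)
elems zero = [] ∷ []
elems (suc k) = map (false ∷_) (elems k) ++ map (true ∷_) (elems k)

dot : ∀ {k} → G k → G k → Bool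
dot [] [] = false
dot (a ∷ σ) (b ∷ τ) = (a Data.Bool.∧ b) xor dot σ τ

-- s = Σ σ_i 2^{k-i}  (σ_1 most significant bit)
index : ∀ {k} → G k → ℕ
index {zero} [] = 0
index {suc k} (b ∷ σ) = (if b then 2 ^ k else 0) + index σ

-- ĥ_k(s), r̂_k(s) for s ∈ {0,…,2^k}, by the recursion in the paper:
-- even s = 2t uses level k at t; odd s = 2t+1 uses t and t+1.
-- Values outside {0,…,2^k} are irrelevant (set to ĥ = 1, r̂ = 0 at level 0).
hh : ℕ → ℕ → ℕ
hh zero s = 1
hh (suc k) s with s % 2
... | 0 = hh k (s / 2)
... | _ = hh k (s / 2) + hh k (s / 2 + 1)

rr : ℕ → ℕ → ℕ
rr zero 0 = 0
rr zero 1 = 1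
rr zero _ = 0
rr (suc k) s with s % 2
... | 0 = rr k (s / 2)
... | _ = rr k (s / 2) + rr k (s / 2 + 1)

hh-pos : ∀ k s → ℕ.NonZero (hh k s)
hh-pos zero s = _
hh-pos (suc k) s with s % 2
... | 0 = hh-pos k (s / 2)
... | suc _ = ℕ.>-nonZero (Data.Nat.Properties.<-≤-trans (ℕ.>-nonZero⁻¹ _ {{hh-pos k (s / 2)}}) (Data.Nat.Properties.m≤m+n _ _))
  where import Data.Nat.Properties

F : (k : ℕ) → G k → ℚ
F k σ = normalize (rr k (index σ)) (hh k (index σ)) {{hh-pos k (index σ)}}

sumℚ : List ℚ → ℚ
sumℚ = foldr Q._+_ 0ℚ

sign : Bool → ℚ → ℚ
sign false q = q
sign true q = - q

j : (k : ℕ) → G k → ℚ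
j k τ = - (normalize 1 (2 ^ k) {{ℕ.>-nonZero (Data.Nat.Properties.m^n>0 2 k)}}
           Q.* sumℚ (map (λ σ → sign (dot σ τ) (F k σ)) (elems k)))
  where import Data.Nat.Properties

zeroG : (k : ℕ) → G k
zeroG zero = []
zeroG (suc k) = false ∷ zeroG k

-- The Stern–Brocot recursion is symmetric under s ↦ 2^k − s: ĥ_k(2^k − s) = ĥ_k(s) and
-- r̂_k(s) + r̂_k(2^k − s) = ĥ_k(s), so F_k(s) + F_k(2^k − s) = 1. Pairing s with 2^k − s
-- over 0 ≤ s ≤ 2^k, and using F_k(0) = 0, F_k(2^k) = 1, gives Σ_{s<2^k} F_k(s) = (2^k − 1)/2,
-- whence j_k(0) = −2^{−k}(2^k − 1)/2. Since F_k ≥ 0, the character sum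
-- Σ_σ (−1)^{σ·τ} F_k(σ) is largest at τ = 0, so j_k(0) is the minimum of j_k.
module Submission where

open import Algebra.Bundles using (CommutativeMonoid)
open import Data.Nat as ℕ using (ℕ; zero; suc; NonZero; _∸_; _^_; _≥_; >-nonZero)
import Data.Nat.Properties as ℕ
open import Data.Nat.Properties using (m^n>0)
open import Function using (_∘_)
open import Relation.Binary.PropositionalEquality using (_≡_; _≢_; refl; sym; trans; cong; cong₂; subst; subst₂; module ≡-Reasoning)

open import Defs

module RangeSum {c ℓ} (M : CommutativeMonoid c ℓ) where

  open CommutativeMonoid M
    using (Carrier; _≈_; _∙_; ε; setoid; ∙-cong; ∙-congˡ; ∙-congʳ; assoc; comm; identityˡ; identityʳ; commutativeSemigroup)
    renaming (refl to ≈-refl; sym to ≈-sym; trans to ≈-trans)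
  open import Algebra.Properties.CommutativeSemigroup commutativeSemigroup using (interchange)
  open import Relation.Binary.Reasoning.Setoid setoid

  ∑< : ℕ → (ℕ → Carrier) → Carrier
  ∑< zero    f = ε
  ∑< (suc n) f = f 0 ∙ ∑< n (f ∘ suc)

  syntax ∑< n (λ i → x) = ∑[ i < n ] x

  ∑-cong : ∀ n {f g : ℕ → Carrier} → (∀ i → i ℕ.< n → f i ≈ g i) → ∑< n f ≈ ∑< n g
  ∑-cong zero    f≈g = ≈-refl
  ∑-cong (suc n) f≈g = ∙-cong (f≈g 0 ℕ.z<s) (∑-cong n (λ i i<n → f≈g (suc i) (ℕ.s<s i<n)))

  ∑-distrib-∙ : ∀ n (f g : ℕ → Carrier) → ∑[ i < n ] (f i ∙ g i) ≈ ∑< n f ∙ ∑< n g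
  ∑-distrib-∙ zero    f g = ≈-sym (identityˡ ε)
  ∑-distrib-∙ (suc n) f g = begin
    (f 0 ∙ g 0) ∙ ∑[ i < n ] (f (suc i) ∙ g (suc i))    ≈⟨ ∙-congˡ (∑-distrib-∙ n (f ∘ suc) (g ∘ suc)) ⟩
    (f 0 ∙ g 0) ∙ (∑< n (f ∘ suc) ∙ ∑< n (g ∘ suc))     ≈⟨ interchange (f 0) (g 0) _ _ ⟩
    (f 0 ∙ ∑< n (f ∘ suc)) ∙ (g 0 ∙ ∑< n (g ∘ suc))     ∎

  ∑-split : ∀ m n (f : ℕ → Carrier) → ∑< (m ℕ.+ n) f ≈ ∑< m f ∙ ∑[ i < n ] f (m ℕ.+ i)
  ∑-split zero    n f = ≈-sym (identityˡ (∑< n f))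
  ∑-split (suc m) n f = begin
    f 0 ∙ ∑< (m ℕ.+ n) (f ∘ suc)                             ≈⟨ ∙-congˡ (∑-split m n (f ∘ suc)) ⟩
    f 0 ∙ (∑< m (f ∘ suc) ∙ ∑[ i < n ] f (suc m ℕ.+ i))      ≈⟨ assoc (f 0) _ _ ⟨
    (f 0 ∙ ∑< m (f ∘ suc)) ∙ ∑[ i < n ] f (suc m ℕ.+ i)      ∎

  ∑-last : ∀ n (f : ℕ → Carrier) → ∑< (suc n) f ≈ ∑< n f ∙ f n
  ∑-last zero    f = ≈-trans (identityʳ (f 0)) (≈-sym (identityˡ (f 0)))
  ∑-last (suc n) f = begin
    f 0 ∙ ∑< (suc n) (f ∘ suc)             ≈⟨ ∙-congˡ (∑-last n (f ∘ suc)) ⟩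
    f 0 ∙ (∑< n (f ∘ suc) ∙ f (suc n))     ≈⟨ assoc (f 0) _ _ ⟨
    (f 0 ∙ ∑< n (f ∘ suc)) ∙ f (suc n)     ∎

  ∑-reverse : ∀ n (f : ℕ → Carrier) → ∑< n f ≈ ∑[ i < n ] f (n ∸ suc i)
  ∑-reverse zero    f = ≈-refl
  ∑-reverse (suc n) f = begin
    ∑< (suc n) f                      ≈⟨ ∑-last n f ⟩
    ∑< n f ∙ f n                      ≈⟨ ∙-congʳ (∑-reverse n f) ⟩
    ∑[ i < n ] f (n ∸ suc i) ∙ f n    ≈⟨ comm _ (f n) ⟩
    f n ∙ ∑[ i < n ] f (n ∸ suc i)    ∎

module FareyRecursion where

  open import Algebra.Properties.CommutativeSemigroup ℕ.+-commutativeSemigroup using (interchange)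
  open import Data.Empty using (⊥-elim)
  open import Data.List using ([]; _∷_)
  open import Data.Nat using (_+_; _*_)
  open import Data.Nat.DivMod using (_%_; _/_; m*n%n≡0; m*n/n≡m; [m+kn]%n≡m%n; +-distrib-/-∣ʳ)
  open import Data.Nat.Divisibility using (divides-refl)
  open import Data.Nat.Properties using (0≢1+n; +-comm; +-suc; *-comm; *-cancelʳ-≡; *-distribʳ-+)
  open import Data.Nat.Tactic.RingSolver using (solve)
  open ≡-Reasoning

  data EvenOdd : ℕ → Set where
    even : ∀ t → EvenOdd (t * 2)
    odd  : ∀ t → EvenOdd (1 + t * 2)

  evenOdd : ∀ n → EvenOdd n
  evenOdd zero = even 0
  evenOdd (suc n) with evenOdd n
  ... | even t = odd t
  ... | odd t  = even (suc t)

  even%2 : ∀ t → t * 2 % 2 ≡ 0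
  even%2 t = m*n%n≡0 t 2

  even/2 : ∀ t → t * 2 / 2 ≡ t
  even/2 t = m*n/n≡m t 2

  odd%2 : ∀ t → (1 + t * 2) % 2 ≡ 1
  odd%2 t = [m+kn]%n≡m%n 1 t 2

  odd/2 : ∀ t → (1 + t * 2) / 2 ≡ t
  odd/2 t = trans (+-distrib-/-∣ʳ 1 {d = 2} (divides-refl t)) (m*n/n≡m t 2)

  even≢odd : ∀ t u → t * 2 ≢ 1 + u * 2
  even≢odd t u eq = 0≢1+n (begin
    0                ≡⟨ even%2 t ⟨
    t * 2 % 2        ≡⟨ cong (_% 2) eq ⟩
    (1 + u * 2) % 2  ≡⟨ odd%2 u ⟩
    1                ∎)

  data Halves (P : ℕ) : ℕ → ℕ → Set where
    even : ∀ t t' → t + t' ≡ P → Halves P (t * 2) (t' * 2)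
    odd  : ∀ t u → suc t + u ≡ P → Halves P (1 + t * 2) (1 + u * 2)

  halves : ∀ P s s' → s + s' ≡ 2 * P → Halves P s s'
  halves P s s' eq with evenOdd s | evenOdd s'
  ... | even t | even t' = even t t' (*-cancelʳ-≡ _ _ 2 (begin
    (t + t') * 2   ≡⟨ *-distribʳ-+ 2 t t' ⟩
    t * 2 + t' * 2 ≡⟨ eq ⟩
    2 * P          ≡⟨ *-comm 2 P ⟩
    P * 2          ∎))
  ... | odd t  | odd u   = odd t u (*-cancelʳ-≡ _ _ 2 (begin
    (suc t + u) * 2             ≡⟨ solve (t ∷ u ∷ []) ⟩
    (1 + t * 2) + (1 + u * 2)   ≡⟨ eq ⟩
    2 * P                       ≡⟨ *-comm 2 P ⟩
    P * 2                       ∎))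
  ... | even t | odd u   = ⊥-elim (even≢odd P (t + u) (begin
    P * 2                 ≡⟨ *-comm P 2 ⟩
    2 * P                 ≡⟨ eq ⟨
    t * 2 + (1 + u * 2)   ≡⟨ solve (t ∷ u ∷ []) ⟩
    1 + (t + u) * 2       ∎))
  ... | odd t  | even u  = ⊥-elim (even≢odd P (t + u) (begin
    P * 2                 ≡⟨ *-comm P 2 ⟩
    2 * P                 ≡⟨ eq ⟨
    (1 + t * 2) + u * 2   ≡⟨ solve (t ∷ u ∷ []) ⟩
    1 + (t + u) * 2       ∎))

  hh-even : ∀ k t → hh (suc k) (t * 2) ≡ hh k t
  hh-even k t rewrite even%2 t | even/2 t = refl

  rr-even : ∀ k t → rr (suc k) (t * 2) ≡ rr k t
  rr-even k t rewrite even%2 t | even/2 t = refl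

  hh-odd : ∀ k t → hh (suc k) (1 + t * 2) ≡ hh k t + hh k (suc t)
  hh-odd k t rewrite odd%2 t | odd/2 t | +-comm t 1 = refl

  rr-odd : ∀ k t → rr (suc k) (1 + t * 2) ≡ rr k t + rr k (suc t)
  rr-odd k t rewrite odd%2 t | odd/2 t | +-comm t 1 = refl

  hh-reflect : ∀ k s s' → s + s' ≡ 2 ^ k → hh k s ≡ hh k s'
  hh-reflect zero    s s' eq = refl
  hh-reflect (suc k) s s' eq with halves (2 ^ k) s s' eq
  ... | even t t' e = begin
    hh (suc k) (t * 2)   ≡⟨ hh-even k t ⟩
    hh k t               ≡⟨ hh-reflect k t t' e ⟩
    hh k t'              ≡⟨ hh-even k t' ⟨
    hh (suc k) (t' * 2)  ∎
  ... | odd t u e = begin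
    hh (suc k) (1 + t * 2)       ≡⟨ hh-odd k t ⟩
    hh k t + hh k (suc t)        ≡⟨ cong₂ _+_ (hh-reflect k t (suc u) (trans (+-suc t u) e)) (hh-reflect k (suc t) u e) ⟩
    hh k (suc u) + hh k u        ≡⟨ +-comm _ (hh k u) ⟩
    hh k u + hh k (suc u)        ≡⟨ hh-odd k u ⟨
    hh (suc k) (1 + u * 2)       ∎

  rr-reflect : ∀ k s s' → s + s' ≡ 2 ^ k → rr k s + rr k s' ≡ hh k s
  rr-reflect zero 0             1 refl = refl
  rr-reflect zero 1             0 refl = refl
  rr-reflect zero (suc (suc _)) _ ()
  rr-reflect (suc k) s s' eq with halves (2 ^ k) s s' eq
  ... | even t t' e = begin
    rr (suc k) (t * 2) + rr (suc k) (t' * 2)  ≡⟨ cong₂ _+_ (rr-even k t) (rr-even k t') ⟩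
    rr k t + rr k t'                          ≡⟨ rr-reflect k t t' e ⟩
    hh k t                                    ≡⟨ hh-even k t ⟨
    hh (suc k) (t * 2)                        ∎
  ... | odd t u e = begin
    rr (suc k) (1 + t * 2) + rr (suc k) (1 + u * 2)   ≡⟨ cong₂ _+_ (rr-odd k t) (rr-odd k u) ⟩
    (rr k t + rr k (suc t)) + (rr k u + rr k (suc u)) ≡⟨ cong (rr k t + rr k (suc t) +_) (+-comm (rr k u) _) ⟩
    (rr k t + rr k (suc t)) + (rr k (suc u) + rr k u) ≡⟨ interchange (rr k t) _ _ _ ⟩
    (rr k t + rr k (suc u)) + (rr k (suc t) + rr k u) ≡⟨ cong₂ _+_ (rr-reflect k t (suc u) (trans (+-suc t u) e)) (rr-reflect k (suc t) u e) ⟩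
    hh k t + hh k (suc t)                             ≡⟨ hh-odd k t ⟨
    hh (suc k) (1 + t * 2)                            ∎

  rr-zero : ∀ k → rr k 0 ≡ 0
  rr-zero zero    = refl
  rr-zero (suc k) = trans (rr-even k 0) (rr-zero k)

open FareyRecursion using (hh-reflect; rr-reflect; rr-zero)

open import Data.Bool using (true; false)
open import Data.List using ([]; _∷_; map; _++_)
import Data.List.Properties as List
open import Data.Product using (_×_; _,_)
open import Data.Vec using ([]; _∷_)
import Data.Integer as ℤ
import Data.Integer.Properties as ℤ
open import Data.Integer.Tactic.RingSolver using (solve-∀)
open import Data.Rational using (ℚ; 0ℚ; 1ℚ; ½; _+_; _*_; _-_; -_; _<_; _≤_; normalize; toℚᵘ)
open import Data.Rational.Properties using (toℚᵘ-injective; toℚᵘ-fromℚᵘ; toℚᵘ-homo-+; toℚᵘ-homo-*; toℚᵘ-cancel-<; normalize-cong; normalize-nonNeg; normalize-pos;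
    +-0-commutativeMonoid; +-0-group; +-identityˡ; +-assoc; +-inverseʳ; +-mono-≤; +-monoˡ-<; *-zeroʳ; *-monoʳ-<-pos; *-monoˡ-≤-nonNeg;
    ≤-refl; ≤-trans; neg-antimono-≤; neg-antimono-<; nonNegative⁻¹; module ≤-Reasoning)
open import Data.Rational.Solver using (module +-*-Solver)
open import Data.Rational.Unnormalised as ℚᵘ using (mkℚᵘ; _≃_; *≡*; *<*)
import Data.Rational.Unnormalised.Properties as ℚᵘ

toℚᵘ-normalize : ∀ m n .{{_ : NonZero n}} → toℚᵘ (normalize m n) ≃ mkℚᵘ (ℤ.+ m) (ℕ.pred n)
toℚᵘ-normalize m (suc d) = toℚᵘ-fromℚᵘ (mkℚᵘ (ℤ.+ m) d)

normalize-+ : ∀ a b n .{{_ : NonZero n}} → normalize a n + normalize b n ≡ normalize (a ℕ.+ b) n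
normalize-+ a b n@(suc d) = toℚᵘ-injective (begin
  toℚᵘ (normalize a n + normalize b n)                ≈⟨ toℚᵘ-homo-+ (normalize a n) (normalize b n) ⟩
  toℚᵘ (normalize a n) ℚᵘ.+ toℚᵘ (normalize b n)      ≈⟨ ℚᵘ.+-cong (toℚᵘ-normalize a n) (toℚᵘ-normalize b n) ⟩
  mkℚᵘ (ℤ.+ a) d ℚᵘ.+ mkℚᵘ (ℤ.+ b) d                  ≈⟨ *≡* (trans (cross (ℤ.+ a) (ℤ.+ b) (ℤ.+ n)) (cong₂ ℤ._*_ (sym (ℤ.pos-+ a b)) (sym (ℤ.pos-* n n)))) ⟩
  mkℚᵘ (ℤ.+ (a ℕ.+ b)) d                            ≈⟨ toℚᵘ-normalize (a ℕ.+ b) n ⟨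
  toℚᵘ (normalize (a ℕ.+ b) n)                        ∎)
  where
  open ℚᵘ.≃-Reasoning
  cross : ∀ A B D → (A ℤ.* D ℤ.+ B ℤ.* D) ℤ.* D ≡ (A ℤ.+ B) ℤ.* (D ℤ.* D)
  cross = solve-∀

normalize-* : ∀ a b m n .{{_ : NonZero m}} .{{_ : NonZero n}} →
              normalize a m * normalize b n ≡ normalize (a ℕ.* b) (m ℕ.* n) {{ℕ.m*n≢0 m n}}
normalize-* a b m@(suc c) n@(suc d) = toℚᵘ-injective (begin
  toℚᵘ (normalize a m * normalize b n)                ≈⟨ toℚᵘ-homo-* (normalize a m) (normalize b n) ⟩
  toℚᵘ (normalize a m) ℚᵘ.* toℚᵘ (normalize b n)      ≈⟨ ℚᵘ.*-cong (toℚᵘ-normalize a m) (toℚᵘ-normalize b n) ⟩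
  mkℚᵘ (ℤ.+ a) c ℚᵘ.* mkℚᵘ (ℤ.+ b) d                  ≈⟨ *≡* (cong (ℤ._* ℤ.+ (m ℕ.* n)) (sym (ℤ.pos-* a b))) ⟩
  mkℚᵘ (ℤ.+ (a ℕ.* b)) (ℕ.pred (m ℕ.* n))           ≈⟨ toℚᵘ-normalize (a ℕ.* b) (m ℕ.* n) ⟨
  toℚᵘ (normalize (a ℕ.* b) (m ℕ.* n))                ∎)
  where open ℚᵘ.≃-Reasoning

normalize-self : ∀ n .{{_ : NonZero n}} → normalize n n ≡ 1ℚ
normalize-self n@(suc _) = toℚᵘ-injective (ℚᵘ.≃-trans (toℚᵘ-normalize n n) (*≡* (ℤ.*-comm (ℤ.+ n) (ℤ.+ 1))))

normalize-zero : ∀ n .{{_ : NonZero n}} → normalize 0 n ≡ 0ℚ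
normalize-zero n@(suc _) = toℚᵘ-injective (ℚᵘ.≃-trans (toℚᵘ-normalize 0 n) (*≡* refl))

normalize-<1 : ∀ {m n} .{{_ : NonZero n}} → m ℕ.< n → normalize m n < 1ℚ
normalize-<1 {m} {n@(suc _)} m<n = toℚᵘ-cancel-< (ℚᵘ.<-respˡ-≃ (ℚᵘ.≃-sym (toℚᵘ-normalize m n))
  (*<* (subst₂ ℤ._<_ (sym (ℤ.*-identityʳ (ℤ.+ m))) (sym (ℤ.*-identityˡ (ℤ.+ n))) (ℤ.+<+ m<n))))

normalize-inverse : ∀ n .{{_ : NonZero n}} → normalize 1 n * normalize n 1 ≡ 1ℚ
normalize-inverse n = begin
  normalize 1 n * normalize n 1                          ≡⟨ normalize-* 1 n n 1 ⟩
  normalize (1 ℕ.* n) (n ℕ.* 1) {{ℕ.m*n≢0 n 1}}          ≡⟨ normalize-cong {{ℕ.m*n≢0 n 1}} (ℕ.*-identityˡ n) (ℕ.*-identityʳ n) ⟩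
  normalize n n                                          ≡⟨ normalize-self n ⟩
  1ℚ                                                     ∎
  where open ≡-Reasoning

open RangeSum +-0-commutativeMonoid

∑-one : ∀ n → ∑[ i < n ] 1ℚ ≡ normalize n 1
∑-one zero    = refl
∑-one (suc n) = trans (cong (1ℚ +_) (∑-one n)) (normalize-+ 1 n 1)

farey : ℕ → ℕ → ℚ
farey k s = normalize (rr k s) (hh k s) {{hh-pos k s}}

farey-reflect : ∀ k s s' → s ℕ.+ s' ≡ 2 ^ k → farey k s + farey k s' ≡ 1ℚ
farey-reflect k s s' eq = begin
  farey k s + farey k s'                       ≡⟨ cong (farey k s +_) (normalize-cong {rr k s'} refl (sym (hh-reflect k s s' eq))) ⟩
  normalize (rr k s) h + normalize (rr k s') h ≡⟨ normalize-+ (rr k s) (rr k s') h ⟩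
  normalize (rr k s ℕ.+ rr k s') h             ≡⟨ normalize-cong {n₁ = h} (rr-reflect k s s' eq) refl ⟩
  normalize h h                                ≡⟨ normalize-self h ⟩
  1ℚ                                           ∎
  where
  open ≡-Reasoning
  h = hh k s
  instance
    _ = hh-pos k s
    _ = hh-pos k s'

farey-zero : ∀ k → farey k 0 ≡ 0ℚ
farey-zero k = trans (normalize-cong (rr-zero k) refl) (normalize-zero (hh k 0))
  where instance _ = hh-pos k 0

farey-top : ∀ k → farey k (2 ^ k) ≡ 1ℚ
farey-top k = begin
  farey k (2 ^ k)               ≡⟨ +-identityˡ _ ⟨
  0ℚ + farey k (2 ^ k)          ≡⟨ cong (_+ farey k (2 ^ k)) (farey-zero k) ⟨
  farey k 0 + farey k (2 ^ k)   ≡⟨ farey-reflect k 0 (2 ^ k) refl ⟩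
  1ℚ                            ∎
  where open ≡-Reasoning

∑-farey : ∀ k → let X = ∑[ s < 2 ^ k ] farey k s in X + X + 1ℚ ≡ normalize (2 ^ k) 1
∑-farey k = ∙-cancelˡ 1ℚ _ _ (begin
  1ℚ + (X + X + 1ℚ)           ≡⟨ regroup X ⟩
  (X + 1ℚ) + (X + 1ℚ)         ≡⟨ cong (λ y → y + y) Y≡X+1 ⟨
  Y + Y                       ≡⟨ Y+Y≡M+1 ⟩
  normalize (suc M) 1         ≡⟨ normalize-+ 1 M 1 ⟨
  1ℚ + normalize M 1          ∎)
  where
  open ≡-Reasoning
  open import Algebra.Properties.Group +-0-group using (∙-cancelˡ)
  open +-*-Solver
  M = 2 ^ k
  f = farey k
  X = ∑< M f
  Y = ∑< (suc M) f
  regroup : ∀ x → 1ℚ + (x + x + 1ℚ) ≡ (x + 1ℚ) + (x + 1ℚ)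
  regroup = solve 1 (λ x → con 1ℚ :+ (x :+ x :+ con 1ℚ) := (x :+ con 1ℚ) :+ (x :+ con 1ℚ)) refl
  Y≡X+1 : Y ≡ X + 1ℚ
  Y≡X+1 = trans (∑-last M f) (cong (X +_) (farey-top k))
  Y+Y≡M+1 : Y + Y ≡ normalize (suc M) 1
  Y+Y≡M+1 = begin
    Y + Y                                 ≡⟨ cong (Y +_) (∑-reverse (suc M) f) ⟩
    Y + ∑[ i < suc M ] f (M ∸ i)          ≡⟨ ∑-distrib-∙ (suc M) f (λ i → f (M ∸ i)) ⟨
    ∑[ i < suc M ] (f i + f (M ∸ i))      ≡⟨ ∑-cong (suc M) (λ i i≤M → farey-reflect k i (M ∸ i) (ℕ.m+[n∸m]≡n (ℕ.≤-pred i≤M))) ⟩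
    ∑[ i < suc M ] 1ℚ                     ≡⟨ ∑-one (suc M) ⟩
    normalize (suc M) 1                   ∎

sumℚ-++ : ∀ xs ys → sumℚ (xs ++ ys) ≡ sumℚ xs + sumℚ ys
sumℚ-++ []       ys = sym (+-identityˡ (sumℚ ys))
sumℚ-++ (x ∷ xs) ys = trans (cong (x +_) (sumℚ-++ xs ys)) (sym (+-assoc x _ _))

sumℚ-map-mono : ∀ {A : Set} {f g : A → ℚ} → (∀ a → f a ≤ g a) → ∀ xs → sumℚ (map f xs) ≤ sumℚ (map g xs)
sumℚ-map-mono f≤g []       = ≤-refl
sumℚ-map-mono f≤g (x ∷ xs) = +-mono-≤ (f≤g x) (sumℚ-map-mono f≤g xs)

sumℚ-elems : ∀ k (g : ℕ → ℚ) → sumℚ (map (g ∘ index) (elems k)) ≡ ∑< (2 ^ k) g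
sumℚ-elems zero    g = refl
sumℚ-elems (suc k) g = begin
  sumℚ (map (g ∘ index) (map (false ∷_) e ++ map (true ∷_) e))
    ≡⟨ cong sumℚ (List.map-++ (g ∘ index) (map (false ∷_) e) _) ⟩
  sumℚ (map (g ∘ index) (map (false ∷_) e) ++ map (g ∘ index) (map (true ∷_) e))
    ≡⟨ sumℚ-++ (map (g ∘ index) (map (false ∷_) e)) _ ⟩
  sumℚ (map (g ∘ index) (map (false ∷_) e)) + sumℚ (map (g ∘ index) (map (true ∷_) e))
    ≡⟨ cong₂ _+_ (cong sumℚ (List.map-∘ e)) (cong sumℚ (List.map-∘ e)) ⟨
  sumℚ (map (g ∘ index) e) + sumℚ (map (λ σ → g (P ℕ.+ index σ)) e)
    ≡⟨ cong₂ _+_ (sumℚ-elems k g) (sumℚ-elems k (λ i → g (P ℕ.+ i))) ⟩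
  ∑< P g + ∑[ i < P ] g (P ℕ.+ i)
    ≡⟨ ∑-split P P g ⟨
  ∑< (P ℕ.+ P) g
    ≡⟨ cong (λ n → ∑< (P ℕ.+ n) g) (ℕ.+-identityʳ P) ⟨
  ∑< (2 ^ suc k) g
    ∎
  where
  open ≡-Reasoning
  e = elems k
  P = 2 ^ k

dot-zeroʳ : ∀ {k} (σ : G k) → dot σ (zeroG k) ≡ false
dot-zeroʳ []          = refl
dot-zeroʳ (false ∷ σ) = dot-zeroʳ σ
dot-zeroʳ (true ∷ σ)  = dot-zeroʳ σ

sign-≤ : ∀ b {x} → 0ℚ ≤ x → sign b x ≤ x
sign-≤ false _   = ≤-refl
sign-≤ true  0≤x = ≤-trans (neg-antimono-≤ 0≤x) 0≤x

F-nonNeg : ∀ k σ → 0ℚ ≤ F k σ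
F-nonNeg k σ = nonNegative⁻¹ (F k σ) {{normalize-nonNeg (rr k (index σ)) (hh k (index σ)) {{hh-pos k (index σ)}}}}

½*[1-1/n]>0 : ∀ {n} .{{_ : NonZero n}} → 1 ℕ.< n → 0ℚ < ½ * (1ℚ - normalize 1 n)
½*[1-1/n]>0 {n} 1<n = begin-strict
  0ℚ                       ≡⟨ *-zeroʳ ½ ⟨
  ½ * 0ℚ                   ≡⟨ cong (½ *_) (+-inverseʳ q) ⟨
  ½ * (q - q)              <⟨ *-monoʳ-<-pos ½ {{normalize-pos 1 2}} (+-monoˡ-< (- q) (normalize-<1 1<n)) ⟩
  ½ * (1ℚ - q)             ∎
  where
  open ≤-Reasoning
  q = normalize 1 n

module _ (k : ℕ) where

  private instance
    2^k≢0 : NonZero (2 ^ k)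
    2^k≢0 = >-nonZero (m^n>0 2 k)

  j-zero : j k (zeroG k) ≡ - (½ * (1ℚ - normalize 1 (2 ^ k)))
  j-zero = cong -_ (begin
    q * sumℚ (map (λ σ → sign (dot σ (zeroG k)) (F k σ)) (elems k))
      ≡⟨ cong (λ xs → q * sumℚ xs) (List.map-cong (λ σ → cong (λ b → sign b (F k σ)) (dot-zeroʳ σ)) (elems k)) ⟩
    q * sumℚ (map (farey k ∘ index) (elems k))   ≡⟨ cong (q *_) (sumℚ-elems k (farey k)) ⟩
    q * X                                        ≡⟨ halve q X ⟩
    ½ * (q * (X + X + 1ℚ) - q)                   ≡⟨ cong (λ y → ½ * (q * y - q)) (∑-farey k) ⟩
    ½ * (q * normalize M 1 - q)                  ≡⟨ cong (λ y → ½ * (y - q)) (normalize-inverse M) ⟩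
    ½ * (1ℚ - q)                                 ∎)
    where
    open ≡-Reasoning
    open +-*-Solver
    M = 2 ^ k
    q = normalize 1 M
    X = ∑[ s < M ] farey k s
    halve : ∀ q x → q * x ≡ ½ * (q * (x + x + 1ℚ) - q)
    halve = solve 2 (λ q x → q :* x := con ½ :* (q :* (x :+ x :+ con 1ℚ) :- q)) refl

  j-zero-minimal : ∀ τ → j k (zeroG k) ≤ j k τ
  j-zero-minimal τ = neg-antimono-≤ (*-monoˡ-≤-nonNeg (normalize 1 (2 ^ k)) {{normalize-nonNeg 1 (2 ^ k)}}
    (sumℚ-map-mono term-≤ (elems k)))
    where
    term-≤ : ∀ σ → sign (dot σ τ) (F k σ) ≤ sign (dot σ (zeroG k)) (F k σ)
    term-≤ σ rewrite dot-zeroʳ σ = sign-≤ (dot σ τ) (F-nonNeg k σ)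

  j-zero-negative : k ≥ 1 → j k (zeroG k) < 0ℚ
  j-zero-negative k≥1 = subst (_< 0ℚ) (sym j-zero)
    (neg-antimono-< (½*[1-1/n]>0 (ℕ.^-monoʳ-< 2 (ℕ.s≤s (ℕ.s≤s ℕ.z≤n)) k≥1)))

proposition4p3 : (k : ℕ) → k ≥ 1 →
    (j k (zeroG k) ≡ - (½ * (1ℚ - normalize 1 (2 ^ k) {{>-nonZero (m^n>0 2 k)}})))
    × (j k (zeroG k) < 0ℚ)
    × ((τ : G k) → j k (zeroG k) ≤ j k τ)
proposition4p3 k k≥1 = j-zero k , j-zero-negative k k≥1 , j-zero-minimal k
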